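{- There exists a partition of the set $\mathbb{T}|_1$ into two sets neither of which is $2^\infty$-summable.
   Context: $\mathbb{N}$ denotes the set of positive integers. The Thue-Morse word is $\mathbb{T}=t_0t_1t_2\ldots\in\{0,1\}^\omega$, where $t_n$ is the sum modulo $2$ of the binary digits of $n$. $\mathbb{T}|_1=\{n\in\mathbb{N}: t_n=1\}$, i.e. the set of positive integers with an odd number of $1$'s in their binary expansion. A sequence $\langle x_t\rangle_{t=1}^\infty$ in $\mathbb{N}$ satisfies uniqueness of finite sums if whenever $F,H$ are finite nonempty subsets of $\mathbb{N}$ with $\sum_{t\in F}x_t=\sum_{t\in H}x_t$, then $F=H$. A set $A\subseteq\mathbb{N}$ is $2^\infty$-summable if there is an infinite sequence $\langle x_t\rangle_{t=1}^\infty$ in $\mathbb{N}$ satisfying uniqueness of finite sums such that $x_n\in A$ for all $n$ and $x_n+x_m\in A$ for all $n\neq m$. -}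

module Defs where

open import Data.Nat using (ℕ; zero; suc; _+_; _≤_; _/_; _%_)
open import Data.Bool using (Bool; true; false; _xor_)
open import Data.List using (List; []; _∷_; map)
open import Data.Nat.ListAction using (sum)
open import Data.List.Membership.Propositional using (_∈_)
open import Data.List.Relation.Unary.Unique.Propositional using (Unique)
open import Data.Product using (Σ; _×_; ∃)
open import Data.Sum using (_⊎_)
open import Data.Empty using (⊥)
open import Function.Bundles using (_⇔_)
open import Relation.Binary.PropositionalEquality using (_≡_; _≢_)
open import Relation.Nullary using (¬_)

-- parity of the number of 1's in the binary expansion of n, computed with fuel
-- (fuel ≥ n suffices, since n halves each step)
parityFuel : ℕ → ℕ → Bool
parityFuel zero    n = false
parityFuel (suc f) zero = false
parityFuel (suc f) n@(suc _) with n % 2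
... | zero = parityFuel f (n / 2)
... | suc _ = parityFuel f (n / 2) xor true

-- Thue–Morse word: t n = sum of binary digits of n, mod 2 (true = 1)
t : ℕ → Bool
t n = parityFuel n n

Subset : Set₁
Subset = ℕ → Set

T₁ : Subset
T₁ n = (1 ≤ n) × (t n ≡ true)

record FinNonEmpty : Set where
  constructor fne
  field
    elems  : List ℕ
    unique : Unique elems
    nonempty : ¬ (elems ≡ [])
open FinNonEmpty public

ΣF : (ℕ → ℕ) → FinNonEmpty → ℕ
ΣF x F = sum (map x (elems F))

_≐_ : FinNonEmpty → FinNonEmpty → Set
F ≐ H = ∀ i → (i ∈ elems F) ⇔ (i ∈ elems H)

UniqueFiniteSums : (ℕ → ℕ) → Set
UniqueFiniteSums x = ∀ (F H : FinNonEmpty) → ΣF x F ≡ ΣF x H → F ≐ H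

Summable2∞ : Subset → Set
Summable2∞ A = Σ (ℕ → ℕ) λ x →
    (∀ n → 1 ≤ x n)
  × UniqueFiniteSums x
  × (∀ n → A (x n))
  × (∀ n m → n ≢ m → A (x n + x m))

IsPartition : Subset → Subset → Subset → Set
IsPartition S A B =
    (∀ n → S n ⇔ (A n ⊎ B n))
  × (∀ n → A n → B n → ⊥)

-- Colour each n by the parity of its 2-adic valuation v₂(n); both colour classes of 𝕋|₁
-- fail to be 2^∞-summable. Given a witness x for one class, take K = x₀, so x₀ < 2^K, and by
-- pigeonhole two further terms a, b with a ≡ b (mod 2^(K+1)). If 2^K ∣ a, the binary digits of
-- x₀ and a do not overlap, so t(x₀ + a) = t(x₀) + t(a) = 0 and x₀ + a ∉ 𝕋|₁. Hence v₂(a) < K,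
-- which forces v₂(a + b) = v₂(2a) = v₂(a) + 1: the pair sum a + b has the other colour than a.
module Submission where

open import Defs
open import Data.Bool using (Bool; true; false; not; _xor_)
open import Data.Bool.Properties
  using (xor-comm; xor-inverseˡ; not-distribˡ-xor; not-distribʳ-xor; not-¬)
open import Data.Empty using (⊥-elim)
open import Data.Fin using (Fin; toℕ; fromℕ<)
open import Data.Fin.Properties using (pigeonhole; toℕ-fromℕ<)
open import Data.Nat using (ℕ; zero; suc; pred; _+_; _*_; _^_; _≤_; _<_; z≤n; s≤s; _/_; _%_; NonZero)
open import Data.Nat.Properties
open import Data.Nat.DivMod
open import Data.Nat.Divisibility
  using (_∣_; 1∣_; _∣0; ∣-trans; n∣m*n; m∣m*n; *-monoʳ-∣; ∣m∣n⇒∣m+n; m∣n⇒n≡m*quotient; quotient)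
open import Data.Nat.Tactic.RingSolver using (solve-∀)
open import Data.Product using (Σ; _×_; _,_; proj₁; proj₂; ∃₂)
open import Data.Sum using (_⊎_; inj₁; inj₂; [_,_])
open import Function using (_∘_)
open import Function.Bundles using (mk⇔)
open import Relation.Binary.PropositionalEquality
  using (_≡_; _≢_; refl; sym; trans; cong; cong₂; subst; module ≡-Reasoning)
open import Relation.Nullary using (¬_)

data EvenOdd : ℕ → Set where
  even : ∀ q → EvenOdd (q * 2)
  odd  : ∀ q → EvenOdd (1 + q * 2)

evenOdd : ∀ n → EvenOdd n
evenOdd zero = even 0
evenOdd (suc n) with evenOdd n
... | even q = odd q
... | odd q  = even (suc q)

q*2<2*Q⇒q<Q : ∀ {q} Q → q * 2 < 2 * Q → q < Q
q*2<2*Q⇒q<Q {q} Q lt = *-cancelʳ-< 2 q Q (subst (q * 2 <_) (*-comm 2 Q) lt)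

n<2^n : ∀ n → n < 2 ^ n
n<2^n zero    = s≤s z≤n
n<2^n (suc n) = ≤-<-trans (n<2^n n) (^-monoʳ-< 2 (s≤s (s≤s z≤n)) (n<1+n n))

regroup : ∀ q Q b → q * 2 + 2 * Q * b ≡ (q + Q * b) * 2
regroup = solve-∀

regroup+1 : ∀ q Q b → 1 + q * 2 + 2 * Q * b ≡ 1 + (q + Q * b) * 2
regroup+1 = solve-∀

regroup-sum : ∀ r Q c d → (r + 2 * Q * c) + (r + 2 * Q * d) ≡ (r + Q * (c + d)) * 2
regroup-sum = solve-∀

parityFuel-zero : ∀ f → parityFuel f 0 ≡ false
parityFuel-zero zero    = refl
parityFuel-zero (suc f) = refl

parityFuel-double : ∀ f q → parityFuel (suc f) (suc q * 2) ≡ parityFuel f (suc q)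
parityFuel-double f q rewrite m*n%n≡0 (suc q) 2 {{_}} = cong (parityFuel f) (m*n/n≡m (suc q) 2)

parityFuel-double+1 : ∀ f q → parityFuel (suc f) (1 + q * 2) ≡ not (parityFuel f q)
parityFuel-double+1 f q rewrite [m+kn]%n≡m%n 1 q 2 {{_}} = begin
  parityFuel f ((1 + q * 2) / 2) xor true  ≡⟨ xor-comm _ true ⟩
  not (parityFuel f ((1 + q * 2) / 2))     ≡⟨ cong (not ∘ parityFuel f) half ⟩
  not (parityFuel f q)                     ∎
  where
  open ≡-Reasoning
  half : (1 + q * 2) / 2 ≡ q
  half = trans (+-distrib-/-∣ʳ 1 {d = 2} (n∣m*n q)) (m*n/n≡m q 2)

parityFuel-sufficient : ∀ {f g n} → EvenOdd n → n ≤ f → n ≤ g → parityFuel f n ≡ parityFuel g n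
parityFuel-sufficient {f} {g} (even zero) _ _ = trans (parityFuel-zero f) (sym (parityFuel-zero g))
parityFuel-sufficient {suc f} {suc g} (even (suc q)) (s≤s p) (s≤s p′) =
  trans (parityFuel-double f q)
    (trans (parityFuel-sufficient (evenOdd (suc q)) (≤-trans q≤ p) (≤-trans q≤ p′))
      (sym (parityFuel-double g q)))
  where
  q≤ : suc q ≤ suc (q * 2)
  q≤ = s≤s (m≤m*n q 2)
parityFuel-sufficient {suc f} {suc g} (odd q) (s≤s p) (s≤s p′) =
  trans (parityFuel-double+1 f q)
    (trans (cong not (parityFuel-sufficient (evenOdd q) (≤-trans q≤ p) (≤-trans q≤ p′)))
      (sym (parityFuel-double+1 g q)))
  where
  q≤ : q ≤ q * 2
  q≤ = m≤m*n q 2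

t-double : ∀ q → t (q * 2) ≡ t q
t-double zero    = refl
t-double (suc q) =
  trans (parityFuel-double (suc (q * 2)) q) (parityFuel-sufficient (evenOdd (suc q)) (s≤s (m≤m*n q 2)) ≤-refl)

t-double+1 : ∀ q → t (1 + q * 2) ≡ not (t q)
t-double+1 q =
  trans (parityFuel-double+1 (q * 2) q) (cong not (parityFuel-sufficient (evenOdd q) (m≤m*n q 2) ≤-refl))

t-+-2^K* : ∀ K a b → a < 2 ^ K → t (a + 2 ^ K * b) ≡ t a xor t b
t-+-2^K* zero    zero    b _ = cong t (+-identityʳ b)
t-+-2^K* zero    (suc a) b (s≤s ())
t-+-2^K* (suc K) a b a< = go (evenOdd a) a<
  where
  Q = 2 ^ K
  go : ∀ {a} → EvenOdd a → a < 2 * Q → t (a + 2 * Q * b) ≡ t a xor t b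
  go (even q) lt = begin
    t (q * 2 + 2 * Q * b)    ≡⟨ cong t (regroup q Q b) ⟩
    t ((q + Q * b) * 2)      ≡⟨ t-double (q + Q * b) ⟩
    t (q + Q * b)            ≡⟨ t-+-2^K* K q b (q*2<2*Q⇒q<Q Q lt) ⟩
    t q xor t b              ≡⟨ cong (_xor t b) (sym (t-double q)) ⟩
    t (q * 2) xor t b        ∎
    where open ≡-Reasoning
  go (odd q) lt = begin
    t (1 + q * 2 + 2 * Q * b)    ≡⟨ cong t (regroup+1 q Q b) ⟩
    t (1 + (q + Q * b) * 2)      ≡⟨ t-double+1 (q + Q * b) ⟩
    not (t (q + Q * b))          ≡⟨ cong not (t-+-2^K* K q b (q*2<2*Q⇒q<Q Q (<-trans (n<1+n _) lt))) ⟩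
    not (t q xor t b)            ≡⟨ not-distribˡ-xor (t q) (t b) ⟩
    not (t q) xor t b            ≡⟨ cong (_xor t b) (sym (t-double+1 q)) ⟩
    t (1 + q * 2) xor t b        ∎
    where open ≡-Reasoning

t-+-multiple : ∀ K {k a} → k < 2 ^ K → 2 ^ K ∣ a → t (k + a) ≡ t k xor t a
t-+-multiple K {k} {a} k< 2^K∣a rewrite m∣n⇒n≡m*quotient 2^K∣a =
  trans (t-+-2^K* K k e k<) (cong (t k xor_) (sym (t-+-2^K* K 0 e (m^n>0 2 K))))
  where e = quotient 2^K∣a

-- Subtracting 1 turns the final block 1 0^v of n into 0 1^v, so t n ≠ t (n − 1) iff v = v₂(n) is even.
evenValuation : ℕ → Bool
evenValuation n = t n xor t (pred n)

evenValuation-odd : ∀ q → evenValuation (1 + q * 2) ≡ true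
evenValuation-odd q = trans (cong₂ _xor_ (t-double+1 q) (t-double q)) (xor-inverseˡ (t q))

evenValuation-double : ∀ q → evenValuation (suc q * 2) ≡ not (evenValuation (suc q))
evenValuation-double q = begin
  t (suc q * 2) xor t (1 + q * 2)  ≡⟨ cong₂ _xor_ (t-double (suc q)) (t-double+1 q) ⟩
  t (suc q) xor not (t q)          ≡⟨ not-distribʳ-xor (t (suc q)) (t q) ⟨
  not (t (suc q) xor t q)          ∎
  where open ≡-Reasoning

evenValuation-+-2^K* : ∀ K r m → ¬ 2 ^ K ∣ r → evenValuation (r + 2 ^ K * m) ≡ evenValuation r
evenValuation-+-2^K* zero    r m ∤r = ⊥-elim (∤r (1∣ r))
evenValuation-+-2^K* (suc K) r m ∤r = go (evenOdd r) ∤r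
  where
  Q = 2 ^ K
  go : ∀ {r} → EvenOdd r → ¬ 2 * Q ∣ r → evenValuation (r + 2 * Q * m) ≡ evenValuation r
  go (even zero)    ∤r = ⊥-elim (∤r (_ ∣0))
  go (even (suc q)) ∤r = begin
    evenValuation (suc q * 2 + 2 * Q * m)
      ≡⟨ cong evenValuation (regroup (suc q) Q m) ⟩
    evenValuation (suc (q + Q * m) * 2)   ≡⟨ evenValuation-double (q + Q * m) ⟩
    not (evenValuation (suc q + Q * m))   ≡⟨ cong not (evenValuation-+-2^K* K (suc q) m ∤q) ⟩
    not (evenValuation (suc q))           ≡⟨ evenValuation-double q ⟨
    evenValuation (suc q * 2)             ∎
    where
    open ≡-Reasoning
    ∤q : ¬ Q ∣ suc q
    ∤q Q∣q = ∤r (subst (2 * Q ∣_) (*-comm 2 (suc q)) (*-monoʳ-∣ 2 Q∣q))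
  go (odd q) _ = begin
    evenValuation (1 + q * 2 + 2 * Q * m)
      ≡⟨ cong evenValuation (regroup+1 q Q m) ⟩
    evenValuation (1 + (q + Q * m) * 2)   ≡⟨ evenValuation-odd (q + Q * m) ⟩
    true                                  ≡⟨ evenValuation-odd q ⟨
    evenValuation (1 + q * 2)             ∎
    where open ≡-Reasoning

evenValuation-residue-sum : ∀ K r c d → ¬ 2 ^ K ∣ r →
  evenValuation ((r + 2 ^ suc K * c) + (r + 2 ^ suc K * d)) ≡ not (evenValuation (r + 2 ^ suc K * c))
evenValuation-residue-sum K zero    c d ∤r = ⊥-elim (∤r (_ ∣0))
evenValuation-residue-sum K (suc r) c d ∤r = begin
  evenValuation ((suc r + 2 * Q * c) + (suc r + 2 * Q * d))  ≡⟨ cong evenValuation (regroup-sum (suc r) Q c d) ⟩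
  evenValuation (suc (r + Q * (c + d)) * 2)                  ≡⟨ evenValuation-double (r + Q * (c + d)) ⟩
  not (evenValuation (suc r + Q * (c + d)))                  ≡⟨ cong not (evenValuation-+-2^K* K (suc r) (c + d) ∤r) ⟩
  not (evenValuation (suc r))                                ≡⟨ cong not (evenValuation-+-2^K* (suc K) (suc r) c ∤2Q) ⟨
  not (evenValuation (suc r + 2 * Q * c))                    ∎
  where
  Q = 2 ^ K
  ∤2Q : ¬ 2 * Q ∣ suc r
  ∤2Q = ∤r ∘ ∣-trans (n∣m*n 2)
  open ≡-Reasoning

evenValuation-+-congruent : ∀ K .{{_ : NonZero (2 ^ suc K)}} {a b} →
  a % 2 ^ suc K ≡ b % 2 ^ suc K → ¬ 2 ^ K ∣ a → evenValuation (a + b) ≡ not (evenValuation a)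
evenValuation-+-congruent K {a} {b} a≡b ∤a = begin
  evenValuation (a + b)                        ≡⟨ cong₂ (λ u v → evenValuation (u + v)) (split a) split-b ⟩
  evenValuation ((r + N * c) + (r + N * d))    ≡⟨ evenValuation-residue-sum K r c d ∤r ⟩
  not (evenValuation (r + N * c))              ≡⟨ cong (not ∘ evenValuation) (split a) ⟨
  not (evenValuation a)                        ∎
  where
  open ≡-Reasoning
  N = 2 ^ suc K
  r = a % N
  c = a / N
  d = b / N
  split : ∀ n → n ≡ n % N + N * (n / N)
  split n = trans (m≡m%n+[m/n]*n n N) (cong (n % N +_) (*-comm (n / N) N))
  split-b : b ≡ r + N * d
  split-b = trans (split b) (cong (_+ N * d) (sym a≡b))
  ∤r : ¬ 2 ^ K ∣ r
  ∤r ∣r = ∤a (subst (2 ^ K ∣_) (sym (split a)) (∣m∣n⇒∣m+n ∣r (∣-trans (n∣m*n 2) (m∣m*n c))))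

residues-collide : ∀ N .{{_ : NonZero N}} (f : ℕ → ℕ) → ∃₂ λ i j → i < j × f i % N ≡ f j % N
residues-collide N f = distinct-indices (pigeonhole (n<1+n N) residue)
  where
  residue : Fin (suc N) → Fin N
  residue i = fromℕ< (m%n<n (f (toℕ i)) N)
  toℕ-residue : ∀ i → toℕ (residue i) ≡ f (toℕ i) % N
  toℕ-residue i = toℕ-fromℕ< (m%n<n (f (toℕ i)) N)
  distinct-indices : (∃₂ λ i j → toℕ i < toℕ j × residue i ≡ residue j) →
                     ∃₂ λ i j → i < j × f i % N ≡ f j % N
  distinct-indices (i , j , i<j , same) =
    toℕ i , toℕ j , i<j , trans (sym (toℕ-residue i)) (trans (cong toℕ same) (toℕ-residue j))

partition-by : (S : Subset) (c : ℕ → Bool) → IsPartition S (λ n → S n × c n ≡ true) (λ n → S n × c n ≡ false)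
partition-by S c = (λ n → mk⇔ (classify n) [ proj₁ , proj₁ ]) , λ n (_ , c≡true) (_ , c≡false) →
  not-¬ refl (trans (sym c≡true) c≡false)
  where
  classify : ∀ n → S n → (S n × c n ≡ true) ⊎ (S n × c n ≡ false)
  classify n s with c n
  ... | true  = inj₁ (s , refl)
  ... | false = inj₂ (s , refl)

valuationClass : Bool → Subset
valuationClass β n = T₁ n × evenValuation n ≡ β

valuationClass-not-summable : ∀ β → ¬ Summable2∞ (valuationClass β)
valuationClass-not-summable β (x , _ , _ , x∈ , sum∈)
  with i , j , i<j , a≡b ← residues-collide (2 ^ suc (x 0)) {{m^n≢0 2 (suc (x 0))}} (x ∘ suc) =
  not-¬ (proj₂ (sum∈ (suc i) (suc j) i≢j)) flip
  where
  K = x 0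
  a = x (suc i)
  i≢j : suc i ≢ suc j
  i≢j = <⇒≢ (s≤s i<j)
  ∤a : ¬ 2 ^ K ∣ a
  ∤a 2^K∣a = not-¬ (proj₂ (proj₁ (sum∈ 0 (suc i) λ ())))
    (trans (t-+-multiple K (n<2^n K) 2^K∣a)
           (cong₂ _xor_ (proj₂ (proj₁ (x∈ 0))) (proj₂ (proj₁ (x∈ (suc i))))))
  flip : evenValuation (a + x (suc j)) ≡ not β
  flip = trans (evenValuation-+-congruent K {{m^n≢0 2 (suc K)}} a≡b ∤a) (cong not (proj₂ (x∈ (suc i))))

lemma9 : Σ Subset λ A → Σ Subset λ B →
    IsPartition T₁ A B × ¬ Summable2∞ A × ¬ Summable2∞ B
lemma9 = valuationClass true , valuationClass false , partition-by T₁ evenValuation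
       , valuationClass-not-summable true , valuationClass-not-summable false
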